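{- In the binary tree instance described in the context, the expected reward of the adaptive policy $\mathcal{A}$ is $\Omega(L)$, i.e., at least $cL$ for an absolute constant $c>0$ and all integers $L\ge 2$.
   Context: Let $L\ge 2$ be an integer, $p:=1/\sqrt{L}$, and $B:=2^{2^{L+1}}$. Let $\mathcal{T}$ be a complete binary tree with root $\rho$ in which every root-to-leaf path has $L$ nodes; each internal node has a left and a right child. The level $\ell(v)$ of a node is the number of nodes on the path from $v$ to a leaf (leaves have level 1, the root level $L$). Each node $v$ has a job with reward $r_v:=(1-p)^{\tau(v)}$, where $\tau(v)$ is the number of right branches on the path from $\rho$ to $v$, and random size $S_v$ which equals $0$ with probability $1-p$ and $s_v>0$ with probability $p$, independently across nodes. Sizes: $s_\rho:=2^{2^L}$, and for a node $v$ with parent $u$, $s_v:=s_u\cdot 2^{2^{\ell(v)}}$ if $v$ is the right child and $s_v:=s_u\cdot 2^{ -2^{\ell(v)}}$ if $v$ is the left child. Residual budgets: $b(\rho):=B$, and $b(v):=b(u)-s_u$ if $v$ is the right child of $u$, $b(v):=s_u$ if $v$ is the left child. Edge lengths: $d(u,v):=0$ if $v$ is the right child of $u$, and $d(u,v):=b(u)-s_u$ if $v$ is the left child. This defines a stochastic orienteering instance on the tree metric with root $\rho$ and budget $B$ (a job's reward is collected iff the total distance travelled plus sizes processed, including this job, is at most $B$). The adaptive policy $\mathcal{A}$ starts at $\rho$, processes the job at the current node, and moves to the left child if the size instantiated to $0$ and to the right child otherwise, until it processes a leaf. -}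

module Defs where

open import Data.Bool using (Bool; true; false; if_then_else_)
open import Data.Nat as ℕ using (ℕ; zero; suc)
import Data.Nat.Properties as ℕ
open import Data.Integer as ℤ using (ℤ; +_)
open import Data.Rational as ℚ using (ℚ; 0ℚ; 1ℚ; _/_)
open import Data.Rational.Properties using (_≤?_)
open import Data.Product using (_×_)
open import Data.Sum using (_⊎_)
open import Relation.Nullary.Decidable using (⌊_⌋)

-- Numbers of the real field ℚ(√L):  a pair (a , b) denotes a + b·√L.
-- The instance's probability p = 1/√L and the expected reward live here.

record QL : Set where
  constructor _⊕_√
  field
    re : ℚ
    im : ℚ
open QL public

-- 1/n for n ≥ 1 (junk value 0 at n = 0, never used since L ≥ 2)
inv : ℕ → ℚ
inv zero    = 0ℚ
inv (suc n) = (+ 1) / suc n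

module Field (L : ℕ) where
  Lℚ : ℚ
  Lℚ = (+ L) / 1

  fromℚ : ℚ → QL
  fromℚ a = a ⊕ 0ℚ √

  _+L_ : QL → QL → QL
  (a ⊕ b √) +L (c ⊕ d √) = (a ℚ.+ c) ⊕ (b ℚ.+ d) √

  _-L_ : QL → QL → QL
  (a ⊕ b √) -L (c ⊕ d √) = (a ℚ.- c) ⊕ (b ℚ.- d) √

  _*L_ : QL → QL → QL
  (a ⊕ b √) *L (c ⊕ d √) =
    (a ℚ.* c ℚ.+ b ℚ.* d ℚ.* Lℚ) ⊕ (a ℚ.* d ℚ.+ b ℚ.* c) √

  invL : ℚ
  invL = inv L

  -- p = 1/√L = (1/L)·√L
  p : QL
  p = 0ℚ ⊕ invL √

  1-p : QL
  1-p = fromℚ 1ℚ -L p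

  -- the real number a + b√L is ≥ 0 (√L ≥ 0 the real square root)
  NonNeg : QL → Set
  NonNeg (a ⊕ b √) =
      (ℚ.0ℚ ℚ.≤ a × ℚ.0ℚ ℚ.≤ b)
    ⊎ (ℚ.0ℚ ℚ.≤ a × b ℚ.< ℚ.0ℚ × b ℚ.* b ℚ.* Lℚ ℚ.≤ a ℚ.* a)
    ⊎ (a ℚ.< ℚ.0ℚ × ℚ.0ℚ ℚ.≤ b × a ℚ.* a ℚ.≤ b ℚ.* b ℚ.* Lℚ)

  _≥L_ : QL → QL → Set
  x ≥L y = NonNeg (x -L y)

pow2 : ℕ → ℚ
pow2 n = (+ (2 ℕ.^ n)) / 1

pow2inv : ℕ → ℚ
pow2inv n = _/_ (+ 1) (2 ℕ.^ n) {{ℕ.m^n≢0 2 n}}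

budget : ℕ → ℚ
budget L = pow2 (2 ℕ.^ (L ℕ.+ 1))

module Instance (L : ℕ) where
  open Field L

  B : ℚ
  B = budget L

  collect : ℚ → QL → QL
  collect t r = if ⌊ t ≤? B ⌋ then r else fromℚ 0ℚ

  -- Expected reward collected by the adaptive policy 𝒜 from the current node v
  -- onwards, where
  --   m      = ℓ(v) - 1  (so m = 0 means v is a leaf),
  --   s      = s_v,  b = b(v),
  --   r      = r_v = (1-p)^τ(v),
  --   t      = total distance travelled plus sizes processed before v's job.
  -- With probability 1-p, S_v = 0: the job is collected iff t ≤ B, and 𝒜 moves
  -- to the left child w (level m) with s_w = s_v·2^(-2^m), b(w) = s_v,
  -- d(v,w) = b(v) - s_v.  With probability p, S_v = s_v: collected iff
  -- t + s_v ≤ B, and 𝒜 moves to the right child w with s_w = s_v·2^(2^m),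
  -- b(w) = b(v) - s_v, d(v,w) = 0, r_w = r_v·(1-p).
  value : (m : ℕ) (s b : ℚ) (r : QL) (t : ℚ) → QL
  value zero s b r t =
    (1-p *L collect t r) +L (p *L collect (t ℚ.+ s) r)
  value (suc m) s b r t =
    (1-p *L (collect t r +L
       value m (s ℚ.* pow2inv (2 ℕ.^ suc m)) s r (t ℚ.+ (b ℚ.- s))))
    +L
    (p *L (collect (t ℚ.+ s) r +L
       value m (s ℚ.* pow2 (2 ℕ.^ suc m)) (b ℚ.- s) (r *L 1-p) ((t ℚ.+ s) ℚ.+ 0ℚ)))

  expectedReward : QL
  expectedReward = value (L ℕ.∸ 1) (pow2 (2 ℕ.^ L)) B (fromℚ 1ℚ) 0ℚ

module Submission where

-- Write V(m, s, b, r, t) (= Instance.value) for the expected reward 𝒜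
-- collects below a node v of level m+1 with size s_v = s, residual budget
-- b(v) = b, reward r_v = r, elapsed time t.  Say that the subtree *fits*
-- if s·c(m) ≤ b and t = B - b, where the capacity c(m) bounds the total size
-- 𝒜 can process below v in units of s_v.  Fitting is inherited by both
-- children (the sizes 2^(2^k) grow fast enough that c(m) + 1 ≤ 2^(2^(m+1))),
-- and it holds at the root.  Hence no job ever overflows the budget, and the
-- recursion for V collapses, because p² = 1/L, to the closed form
--   V(m, s, b, r, t) = r · g(m),   g(0) = 1,  g(m+1) = 1 + (1 - 1/L)·g(m),
-- a geometric sum.  A Bernoulli-type estimate 2g(m) ≥ 2N - N²x (N = m+1,
-- x = 1/L) at N = L gives g(L-1) ≥ L/2, so c = 1/2 works (for every L ≥ 1).

open import Defs
open import Data.Nat using (ℕ; _≤_)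
open import Data.Rational using (ℚ; _<_; 0ℚ; _*_)
open import Data.Product using (Σ; _×_)

open import Data.Nat as ℕ using (zero; suc)
import Data.Nat.Properties as ℕP
open import Data.Integer as ℤ using (+_)
import Data.Integer.Properties as ℤP
open import Data.Rational as ℚ using (1ℚ; _/_; nonNegative; toℚᵘ)
open import Data.Rational.Properties as ℚP hiding (_≤?_)
import Data.Rational.Unnormalised as ℚᵘ
import Data.Rational.Unnormalised.Properties as ℚᵘP
open import Data.Rational.Solver using (module +-*-Solver)
open import Data.Product using (_,_)
open import Data.Sum using (inj₁)
open import Data.Empty using (⊥-elim)
open import Relation.Nullary using (yes; no)
open import Relation.Binary.PropositionalEquality

open +-*-Solver

*-nonNeg : ∀ {x y} → 0ℚ ℚ.≤ x → 0ℚ ℚ.≤ y → 0ℚ ℚ.≤ x ℚ.* y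
*-nonNeg {x} {y} hx hy =
  nonNegative⁻¹ (x ℚ.* y) {{nonNeg*nonNeg⇒nonNeg x {{nonNegative hx}} y {{nonNegative hy}}}}

≤-+-nonNeg : ∀ {x} y → 0ℚ ℚ.≤ x → y ℚ.≤ y ℚ.+ x
≤-+-nonNeg {x} y hx = begin
  y          ≡⟨ sym (+-identityʳ y) ⟩
  y ℚ.+ 0ℚ   ≤⟨ +-monoʳ-≤ y hx ⟩
  y ℚ.+ x    ∎
  where open ≤-Reasoning

-‿nonNeg-≤ : ∀ {x} y → 0ℚ ℚ.≤ x → y ℚ.- x ℚ.≤ y
-‿nonNeg-≤ {x} y hx = begin
  y ℚ.- x        ≤⟨ +-monoʳ-≤ y (neg-antimono-≤ hx) ⟩
  y ℚ.+ ℚ.- 0ℚ   ≡⟨ +-identityʳ y ⟩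
  y              ∎
  where open ≤-Reasoning

≤⇒-nonNeg : ∀ {x y} → x ℚ.≤ y → 0ℚ ℚ.≤ y ℚ.- x
≤⇒-nonNeg {x} {y} h = begin
  0ℚ        ≡⟨ sym (+-inverseʳ x) ⟩
  x ℚ.- x   ≤⟨ +-monoˡ-≤ (ℚ.- x) h ⟩
  y ℚ.- x   ∎
  where open ≤-Reasoning

cast : ℕ → ℚ
cast m = (+ m) / 1

toℚᵘ-/ : ∀ m n → toℚᵘ ((+ m) / suc n) ℚᵘ.≃ ℚᵘ.mkℚᵘ (+ m) n
toℚᵘ-/ m n = toℚᵘ-fromℚᵘ (ℚᵘ.mkℚᵘ (+ m) n)

cast-+ : ∀ m n → cast (m ℕ.+ n) ≡ cast m ℚ.+ cast n
cast-+ m n = toℚᵘ-injective (ℚᵘP.≃-trans (toℚᵘ-/ (m ℕ.+ n) 0)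
   (ℚᵘP.≃-sym (ℚᵘP.≃-trans (toℚᵘ-homo-+ (cast m) (cast n))
     (ℚᵘP.≃-trans (ℚᵘP.+-cong (toℚᵘ-/ m 0) (toℚᵘ-/ n 0)) (ℚᵘ.*≡* cross)))))
  where
  open ≡-Reasoning
  cross : ((+ m) ℤ.* (+ 1) ℤ.+ (+ n) ℤ.* (+ 1)) ℤ.* (+ 1) ≡ (+ (m ℕ.+ n)) ℤ.* (+ 1)
  cross = begin
     ((+ m) ℤ.* (+ 1) ℤ.+ (+ n) ℤ.* (+ 1)) ℤ.* (+ 1)
       ≡⟨ ℤP.*-identityʳ _ ⟩
     (+ m) ℤ.* (+ 1) ℤ.+ (+ n) ℤ.* (+ 1)
       ≡⟨ cong₂ ℤ._+_ (ℤP.*-identityʳ (+ m)) (ℤP.*-identityʳ (+ n)) ⟩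
     (+ m) ℤ.+ (+ n)
       ≡⟨ sym (ℤP.pos-+ m n) ⟩
     + (m ℕ.+ n)
       ≡⟨ sym (ℤP.*-identityʳ _) ⟩
     (+ (m ℕ.+ n)) ℤ.* (+ 1) ∎

cast-* : ∀ m n → cast (m ℕ.* n) ≡ cast m ℚ.* cast n
cast-* m n = toℚᵘ-injective (ℚᵘP.≃-trans (toℚᵘ-/ (m ℕ.* n) 0)
   (ℚᵘP.≃-sym (ℚᵘP.≃-trans (toℚᵘ-homo-* (cast m) (cast n))
     (ℚᵘP.≃-trans (ℚᵘP.*-cong (toℚᵘ-/ m 0) (toℚᵘ-/ n 0))
       (ℚᵘ.*≡* (cong (ℤ._* (+ 1)) (sym (ℤP.pos-* m n))))))))

cast-inverse : ∀ N .{{_ : ℕ.NonZero N}} → ((+ 1) / N) ℚ.* cast N ≡ 1ℚ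
cast-inverse (suc n) = toℚᵘ-injective
  (ℚᵘP.≃-trans (toℚᵘ-homo-* ((+ 1) / suc n) (cast (suc n)))
    (ℚᵘP.≃-trans (ℚᵘP.*-cong (toℚᵘ-/ 1 n) (toℚᵘ-/ (suc n) 0)) (ℚᵘ.*≡* cross)))
  where
  open ≡-Reasoning
  cross : ((+ 1) ℤ.* (+ suc n)) ℤ.* (+ 1) ≡ (+ 1) ℤ.* (+ (suc n ℕ.* 1))
  cross = begin
     ((+ 1) ℤ.* (+ suc n)) ℤ.* (+ 1) ≡⟨ ℤP.*-identityʳ _ ⟩
     (+ 1) ℤ.* (+ suc n)             ≡⟨ cong (λ z → (+ 1) ℤ.* (+ z)) (sym (ℕP.*-identityʳ (suc n))) ⟩
     (+ 1) ℤ.* (+ (suc n ℕ.* 1))     ∎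

cast-nonNeg : ∀ m → 0ℚ ℚ.≤ cast m
cast-nonNeg m = nonNegative⁻¹ (cast m) {{normalize-nonNeg m 1}}

reciprocal-nonNeg : ∀ N .{{_ : ℕ.NonZero N}} → 0ℚ ℚ.≤ (+ 1) / N
reciprocal-nonNeg N = nonNegative⁻¹ ((+ 1) / N) {{normalize-nonNeg 1 N}}

cast-mono : ∀ {m n} → m ℕ.≤ n → cast m ℚ.≤ cast n
cast-mono {m} h with ℕP.m≤n⇒∃[o]m+o≡n h
... | k , refl = begin
   cast m              ≤⟨ ≤-+-nonNeg (cast m) (cast-nonNeg k) ⟩
   cast m ℚ.+ cast k   ≡⟨ sym (cast-+ m k) ⟩
   cast (m ℕ.+ k)      ∎
  where open ≤-Reasoning

doubleExp : ℕ → ℚ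
doubleExp k = pow2 (2 ℕ.^ k)

doubleExp-nonNeg : ∀ k → 0ℚ ℚ.≤ doubleExp k
doubleExp-nonNeg k = cast-nonNeg (2 ℕ.^ (2 ℕ.^ k))

doubleExp-suc : ∀ k → doubleExp (suc k) ≡ doubleExp k ℚ.* doubleExp k
doubleExp-suc k = begin
  cast (2 ℕ.^ (2 ℕ.^ k ℕ.+ (2 ℕ.^ k ℕ.+ 0)))  ≡⟨ cong (λ e → cast (2 ℕ.^ (2 ℕ.^ k ℕ.+ e))) (ℕP.+-identityʳ (2 ℕ.^ k)) ⟩
  cast (2 ℕ.^ (2 ℕ.^ k ℕ.+ 2 ℕ.^ k))          ≡⟨ cong cast (ℕP.^-distribˡ-+-* 2 (2 ℕ.^ k) (2 ℕ.^ k)) ⟩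
  cast (2 ℕ.^ 2 ℕ.^ k ℕ.* 2 ℕ.^ 2 ℕ.^ k)      ≡⟨ cast-* (2 ℕ.^ (2 ℕ.^ k)) (2 ℕ.^ (2 ℕ.^ k)) ⟩
  doubleExp k ℚ.* doubleExp k                 ∎
  where open ≡-Reasoning

two≤doubleExp : ∀ k → cast 2 ℚ.≤ doubleExp (suc k)
two≤doubleExp k = cast-mono (ℕP.^-monoʳ-≤ 2 {1} {2 ℕ.^ suc k} (ℕP.m^n>0 2 (suc k)))

pow2inv-inverse : ∀ n → pow2inv n ℚ.* pow2 n ≡ 1ℚ
pow2inv-inverse n = cast-inverse (2 ℕ.^ n) {{ℕP.m^n≢0 2 n}}

pow2inv-nonNeg : ∀ n → 0ℚ ℚ.≤ pow2inv n
pow2inv-nonNeg n = reciprocal-nonNeg (2 ℕ.^ n) {{ℕP.m^n≢0 2 n}}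

-- Capacity of a subtree of level m+1, in units of the size of its root:
-- along the all-right path, 𝒜 processes s + s·2^(2^m) + ..., and
-- s·capacity m bounds this total.
capacity : ℕ → ℚ
capacity zero    = 1ℚ
capacity (suc m) = 1ℚ ℚ.+ doubleExp (suc m) ℚ.* capacity m

capacity≥1 : ∀ m → 1ℚ ℚ.≤ capacity m
capacity≥1 zero    = ≤-refl
capacity≥1 (suc m) = ≤-+-nonNeg 1ℚ
  (*-nonNeg (doubleExp-nonNeg (suc m)) (≤-trans (≤ᵇ⇒≤ _) (capacity≥1 m)))

-- The capacity stays below the growth factor of the next level; this is what
-- lets a left child (whose budget is its parent's size) fit.
capacity<doubleExp : ∀ m → capacity m ℚ.+ 1ℚ ℚ.≤ doubleExp (suc m)
capacity<doubleExp zero    = ≤ᵇ⇒≤ _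
capacity<doubleExp (suc m) = begin
   (1ℚ ℚ.+ D ℚ.* c) ℚ.+ 1ℚ  ≡⟨ solve 2 (λ d c → (con 1ℚ :+ d :* c) :+ con 1ℚ := d :* c :+ con (cast 2)) refl D c ⟩
   D ℚ.* c ℚ.+ cast 2       ≤⟨ +-monoʳ-≤ (D ℚ.* c) (two≤doubleExp m) ⟩
   D ℚ.* c ℚ.+ D            ≡⟨ solve 2 (λ d c → d :* c :+ d := d :* (c :+ con 1ℚ)) refl D c ⟩
   D ℚ.* (c ℚ.+ 1ℚ)         ≤⟨ *-monoˡ-≤-nonNeg D {{nonNegative (doubleExp-nonNeg (suc m))}} (capacity<doubleExp m) ⟩
   D ℚ.* D                  ≡⟨ sym (doubleExp-suc (suc m)) ⟩
   doubleExp (suc (suc m))  ∎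
  where
  open ≤-Reasoning
  D = doubleExp (suc m)
  c = capacity m

capacity≤doubleExp : ∀ m → capacity m ℚ.≤ doubleExp (suc m)
capacity≤doubleExp m = ≤-trans (≤-+-nonNeg (capacity m) (≤ᵇ⇒≤ _)) (capacity<doubleExp m)

-- The geometric sums g_x(m) = 1 + (1-x) + ... + (1-x)^m, defined by the
-- recursion that the expected reward of 𝒜 satisfies (with x = 1/L).
geom : ℚ → ℕ → ℚ
geom x zero    = 1ℚ
geom x (suc m) = 1ℚ ℚ.+ (1ℚ ℚ.- x) ℚ.* geom x m

two : ℚ
two = 1ℚ ℚ.+ 1ℚ

geom-lower : ∀ {x} → 0ℚ ℚ.≤ x → x ℚ.≤ 1ℚ → ∀ m →
             two ℚ.* cast (suc m) ℚ.- cast (suc m) ℚ.* cast (suc m) ℚ.* x ℚ.≤ two ℚ.* geom x m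
geom-lower {x} 0≤x x≤1 zero =
  -‿nonNeg-≤ (two ℚ.* 1ℚ) (*-nonNeg (*-nonNeg (cast-nonNeg 1) (cast-nonNeg 1)) 0≤x)
geom-lower {x} 0≤x x≤1 (suc m) = begin
    two ℚ.* cast (suc (suc m)) ℚ.- cast (suc (suc m)) ℚ.* cast (suc (suc m)) ℚ.* x
      ≡⟨ cong (λ z → two ℚ.* z ℚ.- z ℚ.* z ℚ.* x) (cast-+ 1 (suc m)) ⟩
    two ℚ.* (1ℚ ℚ.+ N) ℚ.- (1ℚ ℚ.+ N) ℚ.* (1ℚ ℚ.+ N) ℚ.* x
      ≤⟨ ≤-+-nonNeg _ slack-nonNeg ⟩
    two ℚ.* (1ℚ ℚ.+ N) ℚ.- (1ℚ ℚ.+ N) ℚ.* (1ℚ ℚ.+ N) ℚ.* x ℚ.+ (N ℚ.* N ℚ.* x ℚ.* x ℚ.+ x)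
      ≡⟨ solve 2 (λ n x → con two :* (con 1ℚ :+ n) :- (con 1ℚ :+ n) :* (con 1ℚ :+ n) :* x :+ (n :* n :* x :* x :+ x)
                         := con two :+ (con 1ℚ :- x) :* (con two :* n :- n :* n :* x)) refl N x ⟩
    two ℚ.+ (1ℚ ℚ.- x) ℚ.* (two ℚ.* N ℚ.- N ℚ.* N ℚ.* x)
      ≤⟨ +-monoʳ-≤ two (*-monoˡ-≤-nonNeg (1ℚ ℚ.- x) {{nonNegative (≤⇒-nonNeg x≤1)}} (geom-lower 0≤x x≤1 m)) ⟩
    two ℚ.+ (1ℚ ℚ.- x) ℚ.* (two ℚ.* geom x m)
      ≡⟨ solve 2 (λ x g → con two :+ (con 1ℚ :- x) :* (con two :* g) := con two :* (con 1ℚ :+ (con 1ℚ :- x) :* g)) refl x (geom x m) ⟩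
    two ℚ.* geom x (suc m) ∎
  where
  open ≤-Reasoning
  N = cast (suc m)
  slack-nonNeg : 0ℚ ℚ.≤ N ℚ.* N ℚ.* x ℚ.* x ℚ.+ x
  slack-nonNeg = ≤-trans (*-nonNeg (*-nonNeg (*-nonNeg (cast-nonNeg (suc m)) (cast-nonNeg (suc m))) 0≤x) 0≤x)
                         (≤-+-nonNeg _ 0≤x)

-- Symbolic elements a + b√L of ℚ(√L): pairs of solver polynomials, with the
-- operations of Field mirrored componentwise.  An identity in ℚ(√L) whose
-- components are polynomial identities is then proved by the ring solver,
-- one component at a time.
record Symbolic (k : ℕ) : Set where
  constructor _⊕ˢ_
  field
    reˢ imˢ : Polynomial k
open Symbolic

module SymbolicOps {k : ℕ} (l i : Polynomial k) where
  -- l stands for L and i for 1/L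
  _+ˢ_ : Symbolic k → Symbolic k → Symbolic k
  (a ⊕ˢ b) +ˢ (c ⊕ˢ d) = (a :+ c) ⊕ˢ (b :+ d)

  _*ˢ_ : Symbolic k → Symbolic k → Symbolic k
  (a ⊕ˢ b) *ˢ (c ⊕ˢ d) = (a :* c :+ b :* d :* l) ⊕ˢ (a :* d :+ b :* c)

  fromℚˢ : Polynomial k → Symbolic k
  fromℚˢ a = a ⊕ˢ con 0ℚ

  pˢ 1-pˢ : Symbolic k
  pˢ   = con 0ℚ ⊕ˢ i
  1-pˢ = (con 1ℚ :- con 0ℚ) ⊕ˢ (con 0ℚ :- i)

module Arithmetic (n : ℕ) where
  open Field (suc n)

  -- p² = 1/L, in the form (1/L)·(1/L)·L = 1/L
  p²≡invL : invL ℚ.* invL ℚ.* Lℚ ≡ invL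
  p²≡invL = begin
    invL ℚ.* invL ℚ.* Lℚ     ≡⟨ *-assoc invL invL Lℚ ⟩
    invL ℚ.* (invL ℚ.* Lℚ)   ≡⟨ cong (invL ℚ.*_) (cast-inverse (suc n)) ⟩
    invL ℚ.* 1ℚ              ≡⟨ *-identityʳ invL ⟩
    invL                     ∎
    where open ≡-Reasoning

  drop-p²-defect : ∀ a c → a ℚ.+ (invL ℚ.* invL ℚ.* Lℚ ℚ.- invL) ℚ.* c ≡ a
  drop-p²-defect a c = begin
    a ℚ.+ (invL ℚ.* invL ℚ.* Lℚ ℚ.- invL) ℚ.* c  ≡⟨ cong (λ z → a ℚ.+ (z ℚ.- invL) ℚ.* c) p²≡invL ⟩
    a ℚ.+ (invL ℚ.- invL) ℚ.* c                  ≡⟨ solve 3 (λ a i c → a :+ (i :- i) :* c := a) refl a invL c ⟩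
    a                                            ∎
    where open ≡-Reasoning

  *L-identityˡ : ∀ x → fromℚ 1ℚ *L x ≡ x
  *L-identityˡ (a ⊕ b √) = cong₂ _⊕_√
    (solve 3 (λ a b l → con 1ℚ :* a :+ con 0ℚ :* b :* l := a) refl a b Lℚ)
    (solve 2 (λ a b → con 1ℚ :* b :+ con 0ℚ :* a := b) refl a b)

  fromℚ-mono : ∀ {a b} → a ℚ.≤ b → fromℚ b ≥L fromℚ a
  fromℚ-mono a≤b = inj₁ (≤⇒-nonNeg a≤b , ≤ᵇ⇒≤ _)

  leaf-identity : ∀ x → (1-p *L x) +L (p *L x) ≡ x *L fromℚ 1ℚ
  leaf-identity (a ⊕ b √) = cong₂ _⊕_√
    (solve 4 (λ a b i l → let open SymbolicOps l i in
       reˢ ((1-pˢ *ˢ (a ⊕ˢ b)) +ˢ (pˢ *ˢ (a ⊕ˢ b))) := reˢ ((a ⊕ˢ b) *ˢ fromℚˢ (con 1ℚ))) refl a b invL Lℚ)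
    (solve 4 (λ a b i l → let open SymbolicOps l i in
       imˢ ((1-pˢ *ˢ (a ⊕ˢ b)) +ˢ (pˢ *ˢ (a ⊕ˢ b))) := imˢ ((a ⊕ˢ b) *ˢ fromℚˢ (con 1ℚ))) refl a b invL Lℚ)

  -- One step of the recursion for 𝒜: if both children return (their reward)·w,
  -- then, since p² = 1/L, the node returns x·(1 + (1 - 1/L)·w).
  step-identity : ∀ x w →
    (1-p *L (x +L (x *L fromℚ w))) +L (p *L (x +L ((x *L 1-p) *L fromℚ w)))
      ≡ x *L fromℚ (1ℚ ℚ.+ (1ℚ ℚ.- invL) ℚ.* w)
  step-identity (a ⊕ b √) w = cong₂ _⊕_√
    (trans (solve 5 (λ a b w i l →
              reˢ (lhs l i a b w) := reˢ (rhs l i a b w) :+ (i :* i :* l :- i) :* (:- (a :* w)))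
              refl a b w invL Lℚ)
           (drop-p²-defect _ (ℚ.- (a ℚ.* w))))
    (trans (solve 5 (λ a b w i l →
              imˢ (lhs l i a b w) := imˢ (rhs l i a b w) :+ (i :* i :* l :- i) :* (:- (b :* w)))
              refl a b w invL Lℚ)
           (drop-p²-defect _ (ℚ.- (b ℚ.* w))))
    where
    lhs rhs : ∀ {k} (l i a b w : Polynomial k) → Symbolic k
    lhs l i a b w = (1-pˢ *ˢ (x +ˢ (x *ˢ fromℚˢ w))) +ˢ (pˢ *ˢ (x +ˢ ((x *ˢ 1-pˢ) *ˢ fromℚˢ w)))
      where open SymbolicOps l i
            x = a ⊕ˢ b
    rhs l i a b w = (a ⊕ˢ b) *ˢ fromℚˢ (con 1ℚ :+ (con 1ℚ :- i) :* w)
      where open SymbolicOps l i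

module Policy (n : ℕ) where
  open Field (suc n)
  open Instance (suc n)
  open Arithmetic n

  record Fits (m : ℕ) (s b t : ℚ) : Set where
    field
      size-nonNeg : 0ℚ ℚ.≤ s
      within      : s ℚ.* capacity m ℚ.≤ b
      elapsed     : t ≡ B ℚ.- b

  module _ {m s b t} (fits : Fits m s b t) where
    open Fits fits

    size≤budget : s ℚ.≤ b
    size≤budget = begin
      s                      ≡⟨ sym (*-identityʳ s) ⟩
      s ℚ.* 1ℚ               ≤⟨ *-monoˡ-≤-nonNeg s {{nonNegative size-nonNeg}} (capacity≥1 m) ⟩
      s ℚ.* capacity m       ≤⟨ within ⟩
      b                      ∎
      where open ≤-Reasoning

    collected-if-zero : t ℚ.≤ B
    collected-if-zero = subst (ℚ._≤ B) (sym elapsed) (-‿nonNeg-≤ B (≤-trans size-nonNeg size≤budget))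

    collected-if-large : t ℚ.+ s ℚ.≤ B
    collected-if-large = begin
      t ℚ.+ s            ≤⟨ +-monoʳ-≤ t size≤budget ⟩
      t ℚ.+ b            ≡⟨ cong (ℚ._+ b) elapsed ⟩
      B ℚ.- b ℚ.+ b      ≡⟨ solve 2 (λ B b → B :- b :+ b := B) refl B b ⟩
      B                  ∎
      where open ≤-Reasoning

  fits-left : ∀ {m s b t} → Fits (suc m) s b t →
              Fits m (s ℚ.* pow2inv (2 ℕ.^ suc m)) s (t ℚ.+ (b ℚ.- s))
  fits-left {m} {s} {b} {t} fits = record
    { size-nonNeg = *-nonNeg size-nonNeg (pow2inv-nonNeg (2 ℕ.^ suc m))
    ; within      = begin
        s ℚ.* ε ℚ.* capacity m                ≡⟨ *-assoc s ε (capacity m) ⟩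
        s ℚ.* (ε ℚ.* capacity m)              ≤⟨ *-monoˡ-≤-nonNeg s {{nonNegative size-nonNeg}}
                                                   (*-monoˡ-≤-nonNeg ε {{nonNegative (pow2inv-nonNeg (2 ℕ.^ suc m))}}
                                                     (capacity≤doubleExp m)) ⟩
        s ℚ.* (ε ℚ.* doubleExp (suc m))       ≡⟨ cong (s ℚ.*_) (pow2inv-inverse (2 ℕ.^ suc m)) ⟩
        s ℚ.* 1ℚ                              ≡⟨ *-identityʳ s ⟩
        s                                     ∎
    ; elapsed     = trans (cong (ℚ._+ (b ℚ.- s)) elapsed)
                      (solve 3 (λ B b s → B :- b :+ (b :- s) := B :- s) refl B b s)
    }
    where
    open Fits fits
    open ≤-Reasoning
    ε = pow2inv (2 ℕ.^ suc m)

  fits-right : ∀ {m s b t} → Fits (suc m) s b t →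
               Fits m (s ℚ.* doubleExp (suc m)) (b ℚ.- s) ((t ℚ.+ s) ℚ.+ 0ℚ)
  fits-right {m} {s} {b} {t} fits = record
    { size-nonNeg = *-nonNeg size-nonNeg (doubleExp-nonNeg (suc m))
    ; within      = begin
        s ℚ.* D ℚ.* capacity m                     ≡⟨ solve 3 (λ s d c → s :* d :* c := s :* (con 1ℚ :+ d :* c) :- s) refl s D (capacity m) ⟩
        s ℚ.* (1ℚ ℚ.+ D ℚ.* capacity m) ℚ.- s      ≤⟨ +-monoˡ-≤ (ℚ.- s) within ⟩
        b ℚ.- s                                    ∎
    ; elapsed     = trans (cong (λ z → (z ℚ.+ s) ℚ.+ 0ℚ) elapsed)
                      (solve 3 (λ B b s → B :- b :+ s :+ con 0ℚ := B :- (b :- s)) refl B b s)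
    }
    where
    open Fits fits
    open ≤-Reasoning
    D = doubleExp (suc m)

  fits-root : Fits n (doubleExp (suc n)) B 0ℚ
  fits-root = record
    { size-nonNeg = doubleExp-nonNeg (suc n)
    ; within      = begin
        D ℚ.* capacity n          ≤⟨ *-monoˡ-≤-nonNeg D {{nonNegative (doubleExp-nonNeg (suc n))}} (capacity≤doubleExp n) ⟩
        D ℚ.* D                   ≡⟨ sym (doubleExp-suc (suc n)) ⟩
        doubleExp (suc (suc n))   ≡⟨ cong doubleExp (ℕP.+-comm 1 (suc n)) ⟩
        B                         ∎
    ; elapsed     = sym (+-inverseʳ B)
    }
    where
    open ≤-Reasoning
    D = doubleExp (suc n)

  collect-within : ∀ {t} r → t ℚ.≤ B → collect t r ≡ r
  collect-within {t} r t≤B with t ℚP.≤? B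
  ... | yes _   = refl
  ... | no t≰B = ⊥-elim (t≰B t≤B)

  closed-form : ∀ m {s b t} r → Fits m s b t → value m s b r t ≡ r *L fromℚ (geom invL m)
  closed-form zero {s} {b} {t} r fits = begin
    (1-p *L collect t r) +L (p *L collect (t ℚ.+ s) r)
      ≡⟨ cong₂ (λ x y → (1-p *L x) +L (p *L y))
               (collect-within r (collected-if-zero fits)) (collect-within r (collected-if-large fits)) ⟩
    (1-p *L r) +L (p *L r)
      ≡⟨ leaf-identity r ⟩
    r *L fromℚ 1ℚ ∎
    where open ≡-Reasoning
  closed-form (suc m) {s} {b} {t} r fits = begin
    value (suc m) s b r t
      ≡⟨ cong₂ (λ x y → (1-p *L x) +L (p *L y))
           (cong₂ _+L_ (collect-within r (collected-if-zero fits)) (closed-form m r (fits-left fits)))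
           (cong₂ _+L_ (collect-within r (collected-if-large fits)) (closed-form m (r *L 1-p) (fits-right fits))) ⟩
    (1-p *L (r +L (r *L fromℚ g))) +L (p *L (r +L ((r *L 1-p) *L fromℚ g)))
      ≡⟨ step-identity r g ⟩
    r *L fromℚ (geom invL (suc m)) ∎
    where
    open ≡-Reasoning
    g = geom invL m

  expectedReward-closed : expectedReward ≡ fromℚ (geom invL n)
  expectedReward-closed = trans (closed-form n (fromℚ 1ℚ) fits-root) (*L-identityˡ (fromℚ (geom invL n)))

  half-L≤geom : ℚ.½ ℚ.* Lℚ ℚ.≤ geom invL n
  half-L≤geom = begin
    ℚ.½ ℚ.* Lℚ                     ≡⟨ cong (ℚ.½ ℚ.*_) (sym two-L-minus-L) ⟩
    ℚ.½ ℚ.* (two ℚ.* Lℚ ℚ.- Lℚ ℚ.* Lℚ ℚ.* invL)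
                                   ≤⟨ *-monoˡ-≤-nonNeg ℚ.½ {{nonNegative {ℚ.½} (≤ᵇ⇒≤ _)}}
                                        (geom-lower (reciprocal-nonNeg (suc n)) invL≤1 n) ⟩
    ℚ.½ ℚ.* (two ℚ.* geom invL n)  ≡⟨ solve 1 (λ g → con ℚ.½ :* (con two :* g) := g) refl (geom invL n) ⟩
    geom invL n                    ∎
    where
    open ≤-Reasoning
    invL≤1 : invL ℚ.≤ 1ℚ
    invL≤1 = begin
      invL              ≡⟨ sym (*-identityʳ invL) ⟩
      invL ℚ.* 1ℚ       ≤⟨ *-monoˡ-≤-nonNeg invL {{nonNegative (reciprocal-nonNeg (suc n))}} (cast-mono {1} {suc n} (ℕ.s≤s ℕ.z≤n)) ⟩
      invL ℚ.* Lℚ       ≡⟨ cast-inverse (suc n) ⟩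
      1ℚ                ∎
    two-L-minus-L : two ℚ.* Lℚ ℚ.- Lℚ ℚ.* Lℚ ℚ.* invL ≡ Lℚ
    two-L-minus-L = begin-equality
      two ℚ.* Lℚ ℚ.- Lℚ ℚ.* Lℚ ℚ.* invL  ≡⟨ solve 2 (λ l i → con two :* l :- l :* l :* i := l :+ l :* (con 1ℚ :- i :* l)) refl Lℚ invL ⟩
      Lℚ ℚ.+ Lℚ ℚ.* (1ℚ ℚ.- invL ℚ.* Lℚ) ≡⟨ cong (λ z → Lℚ ℚ.+ Lℚ ℚ.* (1ℚ ℚ.- z)) (cast-inverse (suc n)) ⟩
      Lℚ ℚ.+ Lℚ ℚ.* (1ℚ ℚ.- 1ℚ)          ≡⟨ solve 1 (λ l → l :+ l :* (con 1ℚ :- con 1ℚ) := l) refl Lℚ ⟩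
      Lℚ                                 ∎

  expectedReward≥half-L : expectedReward ≥L fromℚ (ℚ.½ ℚ.* Lℚ)
  expectedReward≥half-L = subst (_≥L fromℚ (ℚ.½ ℚ.* Lℚ)) (sym expectedReward-closed) (fromℚ-mono half-L≤geom)

lemma1 : Σ ℚ (λ c → (0ℚ < c) × ((L : ℕ) → 2 ≤ L → Field._≥L_ L (Instance.expectedReward L) (Field.fromℚ L (c * Field.Lℚ L))))
lemma1 = ℚ.½ , positive⁻¹ ℚ.½ , λ { zero () ; (suc n) _ → Policy.expectedReward≥half-L n }
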